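{- Let $N\ge2$. If $S$ and $S'$ are distinct final states, each reachable from some clusteron of size $N$, then $S$ and $S'$ have different centroids.
   Context: Rooms are indexed by the integers, room $i$ adjacent to rooms $i\pm1$. A state is a function $a:\mathbb{Z}\to\mathbb{Z}_{\ge0}$ with finite support ($a_i$ = number of indistinguishable violinists in room $i$), of size $N=\sum_i a_i$. Room $i$ is occupied if $a_i\ge1$. A move is possible whenever two adjacent rooms $i,i+1$ are both occupied: one violinist leaves room $i$ for the nearest unoccupied room to the left of $i$, and one violinist leaves room $i+1$ for the nearest unoccupied room to the right of $i+1$. A state is final if no move is possible; reachable means obtained by a finite (possibly empty) sequence of moves. A clusteron is a state whose occupied rooms form a nonempty set of consecutive rooms. The centroid of a state is $\frac1N\sum_i a_i\, i$. -}

module Defs where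

open import Data.Nat as ℕ using (ℕ; zero; suc)
open import Data.Integer as ℤ using (ℤ; +_; _<_; _≤_; _+_; _*_)
open import Data.Rational using (ℚ; _/_; 0ℚ)
open import Data.Product using (Σ; ∃; _×_; _,_)
open import Relation.Binary.PropositionalEquality using (_≡_; _≢_)
open import Relation.Nullary using (¬_; yes; no)

record State : Set where
  field
    occ     : ℤ → ℕ
    lo      : ℤ
    len     : ℕ
    support : ∀ i → occ i ≢ 0 → (lo ≤ i) × (i < lo + + len)
open State public

Occupied : State → ℤ → Set
Occupied S i = 0 ℕ.< occ S i

windowSum : (ℤ → ℤ) → ℤ → ℕ → ℤ
windowSum f lo zero    = + 0
windowSum f lo (suc n) = f (lo + + n) + windowSum f lo n

size : State → ℕ
size S = ℤ.∣ windowSum (λ i → + occ S i) (lo S) (len S) ∣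

moment : State → ℤ
moment S = windowSum (λ i → + occ S i * i) (lo S) (len S)

-- centroid = moment / size  (the empty state, which never occurs here,
-- is given centroid 0 by convention)
centroid : State → ℚ
centroid S with size S
... | zero  = 0ℚ
... | suc n = moment S / suc n

δ : ℤ → ℤ → ℕ
δ i j with i ℤ.≟ j
... | yes _ = 1
... | no  _ = 0

-- One move at the adjacent occupied pair (i, i+1): one violinist goes from
-- room i to the nearest unoccupied room l left of i, and one from room i+1
-- to the nearest unoccupied room r right of i+1.
Move : State → State → Set
Move S T = Σ ℤ λ i → Σ ℤ λ l → Σ ℤ λ r →
    Occupied S i × Occupied S (i + + 1)
  × (l < i) × (occ S l ≡ 0) × (∀ k → l < k → k < i → Occupied S k)
  × (i + + 1 < r) × (occ S r ≡ 0) × (∀ k → i + + 1 < k → k < r → Occupied S k)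
  × (∀ j → occ T j ℕ.+ δ i j ℕ.+ δ (i + + 1) j ≡ occ S j ℕ.+ δ l j ℕ.+ δ r j)

data Reachable : State → State → Set where
  done : ∀ {S} → Reachable S S
  step : ∀ {S T U} → Move S T → Reachable T U → Reachable S U

Final : State → Set
Final S = ¬ (Σ ℤ λ i → Occupied S i × Occupied S (i + + 1))

Clusteron : ℕ → State → Set
Clusteron N C = size C ≡ N × Σ ℤ λ L → Σ ℤ λ U → L ≤ U ×
  (∀ i → (Occupied C i → L ≤ i × i ≤ U) × (L ≤ i × i ≤ U → Occupied C i))

-- Weigh an empty room −1 and a room holding k violinists k.  Starting from a clusteron on at
-- least two rooms, moves preserve two invariants: a room holding two or more violinists has an
-- occupied neighbour, and the weights strictly between two occupied rooms sum to at least −2.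
-- In a final state the first invariant leaves one violinist in every occupied room, so the
-- weights between two occupied rooms sum to −1 minus the number of adjacent pairs of empty rooms
-- between them, and the second invariant allows at most one such pair; the last move always
-- creates one.  Hence the final state reads (10)^L 0 (10)^R from some room a on, with L, R ≥ 1,
-- and its moment is N (a + N − 1) + R for N = L + R.  As 0 < R < N, the centroid
-- a + N − 1 + R/N determines a, L and R, hence the state.  A clusteron on a single room admits
-- no move, and its centroid is an integer.

module Submission where

open import Defs
open import Data.Empty using (⊥; ⊥-elim)
open import Data.Integer as ℤ
  using (ℤ; +_; -1ℤ; _+_; _*_; _-_; -_; _≤_; _<_; +≤+; +<+; -≤+; -≤-)
open import Data.Integer.Properties
open import Data.Integer.Tactic.RingSolver using (solve-∀)
open import Algebra.Properties.AbelianGroup +-0-abelianGroup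
  using () renaming (∙-cancelˡ to +-cancelˡ-≡; ∙-cancelʳ to +-cancelʳ-≡)
open import Data.Nat as ℕ using (ℕ; zero; suc; z≤n; s≤s)
import Data.Nat.Properties as ℕ
open import Data.Product using (∃; _×_; _,_; proj₁; proj₂)
open import Data.Rational using (_/_)
open import Data.Rational.Properties using (/-injective-≃)
open import Data.Rational.Unnormalised using (mkℚᵘ; *≡*)
open import Data.Sum as Sum using (_⊎_; inj₁; inj₂)
open import Data.Unit using (⊤; tt)
open import Function using (_∘_)
open import Relation.Binary.Definitions using (tri<; tri≈; tri>)
open import Relation.Binary.PropositionalEquality
open import Relation.Nullary using (¬_; yes; no)
open import Relation.Unary using (Decidable)

open ≡-Reasoning


i≤j⇒j≡i+n : ∀ {i j} → i ≤ j → ∃ λ n → j ≡ i + + n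
i≤j⇒j≡i+n {i} {j} i≤j = ℤ.∣ j - i ∣ , (begin
  j                  ≡⟨ j≡i+[j-i] i j ⟩
  i + (j - i)        ≡⟨ cong (_+_ i) (sym (0≤i⇒+∣i∣≡i (i≤j⇒0≤j-i i≤j))) ⟩
  i + + ℤ.∣ j - i ∣  ∎)
  where
  j≡i+[j-i] : ∀ i j → j ≡ i + (j - i)
  j≡i+[j-i] = solve-∀

i+1+n≡i+[1+n] : ∀ i n → i + + 1 + + n ≡ i + + suc n
i+1+n≡i+[1+n] i n = +-assoc i (+ 1) (+ n)

i+m+n≡i+[m+n] : ∀ i m n → i + + m + + n ≡ i + + (m ℕ.+ n)
i+m+n≡i+[m+n] i m n = trans (+-assoc i (+ m) (+ n)) (cong (_+_ i) (sym (pos-+ m n)))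

i+1+1≡i+2 : ∀ i → i + + 1 + + 1 ≡ i + + 2
i+1+1≡i+2 i = +-assoc i (+ 1) (+ 1)

i+1+1+1≡i+3 : ∀ i → i + + 1 + + 1 + + 1 ≡ i + + 3
i+1+1+1≡i+3 = solve-∀

i-1+1≡i : ∀ i → i - + 1 + + 1 ≡ i
i-1+1≡i = solve-∀

i+1-1≡i : ∀ i → i + + 1 - + 1 ≡ i
i+1-1≡i = solve-∀

+-offset-injective : ∀ i {m n} → i + + m ≡ i + + n → m ≡ n
+-offset-injective i eq = +-injective (+-cancelˡ-≡ i _ _ eq)

i≤i+n : ∀ i n → i ≤ i + + n
i≤i+n i n = i≤i+j i (+ n)

i<i+1+n : ∀ i n → i < i + + suc n
i<i+1+n i n = subst (_< i + + suc n) (+-identityʳ i) (+-monoʳ-< i (+<+ (s≤s z≤n)))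

i+n<i+[1+n] : ∀ i n → i + + n < i + + suc n
i+n<i+[1+n] i n = +-monoʳ-< i (+<+ ℕ.≤-refl)

i<i+1 : ∀ i → i < i + + 1
i<i+1 i = i<i+1+n i 0

i+1<i+2+n : ∀ i n → i + + 1 < i + + suc (suc n)
i+1<i+2+n i n = subst (i + + 1 <_) (i+1+n≡i+[1+n] i (suc n)) (i<i+1+n (i + + 1) n)

i<j⇒i+1≤j : ∀ {i j} → i < j → i + + 1 ≤ j
i<j⇒i+1≤j {i} i<j = subst (_≤ _) (+-comm (+ 1) i) (i<j⇒suc[i]≤j i<j)

i+1≤j⇒i<j : ∀ {i j} → i + + 1 ≤ j → i < j
i+1≤j⇒i<j {i} = <-≤-trans (i<i+1 i)

i<j⇒i≤j-1 : ∀ {i j} → i < j → i ≤ j - + 1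
i<j⇒i≤j-1 {i} {j} i<j = subst (_≤ j - + 1) (i+1-1≡i i) (+-monoˡ-≤ -1ℤ (i<j⇒i+1≤j i<j))

i≤j-1⇒i<j : ∀ {i j} → i ≤ j - + 1 → i < j
i≤j-1⇒i<j {i} {j} i≤j-1 = i+1≤j⇒i<j (subst (i + + 1 ≤_) (i-1+1≡i j) (+-monoˡ-≤ (+ 1) i≤j-1))

0≤+n : ∀ n → + 0 ≤ + n
0≤+n n = +≤+ z≤n

i-1<i : ∀ i → i - + 1 < i
i-1<i i = i≤j-1⇒i<j ≤-refl

i<j⇒j≡i+1+n : ∀ {i j} → i < j → ∃ λ n → j ≡ i + + suc n
i<j⇒j≡i+1+n {i} i<j with i≤j⇒j≡i+n (i<j⇒i+1≤j i<j)
... | n , eq = n , trans eq (i+1+n≡i+[1+n] i n)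

2*[1+m]≡2+2*m : ∀ m → 2 ℕ.* suc m ≡ suc (suc (2 ℕ.* m))
2*[1+m]≡2+2*m m = ℕ.*-suc 2 m

i+2[1+m]≡i+2m+2 : ∀ i m → i + + (2 ℕ.* suc m) ≡ i + + (2 ℕ.* m) + + 2
i+2[1+m]≡i+2m+2 i m = trans (cong (λ k → i + + k) (trans (2*[1+m]≡2+2*m m) (ℕ.+-comm 2 (2 ℕ.* m))))
                            (sym (i+m+n≡i+[m+n] i (2 ℕ.* m) 2))

-2≤x-1⇒-1≤x : ∀ {x} → - + 2 ≤ x - + 1 → -1ℤ ≤ x
-2≤x-1⇒-1≤x {x} -2≤x-1 = subst (-1ℤ ≤_) (i-1+1≡i x) (+-monoˡ-≤ (+ 1) -2≤x-1)

0≤x+[a+b]⇒-2≤x : ∀ {x a b} → + 0 ≤ x + (a + b) → a ≤ + 1 → b ≤ + 1 → - + 2 ≤ x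
0≤x+[a+b]⇒-2≤x {x} 0≤x+[a+b] a≤1 b≤1 = subst (- + 2 ≤_) (x+2-2≡x x)
  (+-monoˡ-≤ (- + 2) (≤-trans 0≤x+[a+b] (+-monoʳ-≤ x (+-mono-≤ a≤1 b≤1))))
  where
  x+2-2≡x : ∀ x → x + (+ 1 + + 1) + - + 2 ≡ x
  x+2-2≡x = solve-∀

least : (P : ℤ → Set) → Decidable P → ∀ {b x} → (∀ j → P j → b ≤ j) → P x →
        ∃ λ p → P p × (∀ j → P j → p ≤ j)
least P P? {b} {x} b≤P Px with i≤j⇒j≡i+n (b≤P x Px)
... | n , refl = search n b≤P Px
  where
  search : ∀ n {b} → (∀ j → P j → b ≤ j) → P (b + + n) →
           ∃ λ p → P p × (∀ j → P j → p ≤ j)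
  search n {b} b≤P Pb+n with P? b
  search n {b} b≤P Pb+n | yes Pb = b , Pb , b≤P
  search zero    {b} b≤P Pb+n | no ¬Pb = ⊥-elim (¬Pb (subst P (+-identityʳ b) Pb+n))
  search (suc n) {b} b≤P Pb+n | no ¬Pb = search n
    (λ j Pj → i<j⇒i+1≤j (≤∧≢⇒< (b≤P j Pj) λ { refl → ¬Pb Pj }))
    (subst P (sym (i+1+n≡i+[1+n] b n)) Pb+n)

greatest : (P : ℤ → Set) → Decidable P → ∀ {b x} → (∀ j → P j → j ≤ b) → P x →
           ∃ λ q → P q × (∀ j → P j → j ≤ q)
greatest P P? {b} {x} P≤b Px with i≤j⇒j≡i+n (P≤b x Px)
... | n , b≡x+n = search n P≤b (subst P (sym (trans (cong (_- + n) b≡x+n) (x+n-n≡x x (+ n)))) Px)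
  where
  x+n-n≡x : ∀ x n → x + n - n ≡ x
  x+n-n≡x = solve-∀
  search : ∀ n {b} → (∀ j → P j → j ≤ b) → P (b - + n) →
           ∃ λ q → P q × (∀ j → P j → j ≤ q)
  search n {b} P≤b Pb-n with P? b
  search n {b} P≤b Pb-n | yes Pb = b , Pb , P≤b
  search zero    {b} P≤b Pb-n | no ¬Pb = ⊥-elim (¬Pb (subst P (+-identityʳ b) Pb-n))
  search (suc n) {b} P≤b Pb-n | no ¬Pb = search n
    (λ j Pj → i<j⇒i≤j-1 (≤∧≢⇒< (P≤b j Pj) λ { refl → ¬Pb Pj }))
    (subst P (b-[1+n]≡b-1-n b (+ n)) Pb-n)
    where
    b-[1+n]≡b-1-n : ∀ b n → b - (+ 1 + n) ≡ b - + 1 - n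
    b-[1+n]≡b-1-n = solve-∀


windowSum-++ : ∀ f a m n → windowSum f a (m ℕ.+ n) ≡ windowSum f a m + windowSum f (a + + m) n
windowSum-++ f a m zero rewrite ℕ.+-identityʳ m = sym (+-identityʳ _)
windowSum-++ f a m (suc n) rewrite ℕ.+-suc m n = begin
  f (a + + (m ℕ.+ n)) + windowSum f a (m ℕ.+ n)
    ≡⟨ cong₂ (λ j s → f j + s) (sym (i+m+n≡i+[m+n] a m n)) (windowSum-++ f a m n) ⟩
  f (a + + m + + n) + (windowSum f a m + windowSum f (a + + m) n)
    ≡⟨ x+[y+z]≡y+[x+z] (f (a + + m + + n)) (windowSum f a m) _ ⟩
  windowSum f a m + (f (a + + m + + n) + windowSum f (a + + m) n) ∎
  where
  x+[y+z]≡y+[x+z] : ∀ x y z → x + (y + z) ≡ y + (x + z)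
  x+[y+z]≡y+[x+z] = solve-∀

windowSum-1 : ∀ f x → windowSum f x 1 ≡ f x
windowSum-1 f x = trans (+-identityʳ _) (cong f (+-identityʳ x))

windowSum-suc : ∀ f a n → windowSum f a (suc n) ≡ f a + windowSum f (a + + 1) n
windowSum-suc f a n = trans (windowSum-++ f a 1 n) (cong (_+ windowSum f (a + + 1) n) (windowSum-1 f a))

windowSum-2[1+k] : ∀ f b k →
  windowSum f b (2 ℕ.* suc k) ≡ f b + (f (b + + 1) + windowSum f (b + + 2) (2 ℕ.* k))
windowSum-2[1+k] f b k = begin
  windowSum f b (2 ℕ.* suc k)
    ≡⟨ cong (windowSum f b) (2*[1+m]≡2+2*m k) ⟩
  windowSum f b (suc (suc (2 ℕ.* k)))
    ≡⟨ windowSum-suc f b _ ⟩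
  f b + windowSum f (b + + 1) (suc (2 ℕ.* k))
    ≡⟨ cong (_+_ (f b)) (windowSum-suc f (b + + 1) _) ⟩
  f b + (f (b + + 1) + windowSum f (b + + 1 + + 1) (2 ℕ.* k))
    ≡⟨ cong (λ c → f b + (f (b + + 1) + windowSum f c (2 ℕ.* k))) (i+1+1≡i+2 b) ⟩
  f b + (f (b + + 1) + windowSum f (b + + 2) (2 ℕ.* k)) ∎

windowSum-cong : ∀ {f g} a n → (∀ j → a ≤ j → j < a + + n → f j ≡ g j) →
                 windowSum f a n ≡ windowSum g a n
windowSum-cong a zero f≗g = refl
windowSum-cong a (suc n) f≗g = cong₂ _+_ (f≗g _ (i≤i+n a n) (i+n<i+[1+n] a n))
  (windowSum-cong a n λ j a≤j j<a+n → f≗g j a≤j (<-trans j<a+n (i+n<i+[1+n] a n)))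

windowSum-mono-≤ : ∀ {f g} a n → (∀ j → a ≤ j → j < a + + n → f j ≤ g j) →
                   windowSum f a n ≤ windowSum g a n
windowSum-mono-≤ a zero f≤g = ≤-refl
windowSum-mono-≤ a (suc n) f≤g = +-mono-≤ (f≤g _ (i≤i+n a n) (i+n<i+[1+n] a n))
  (windowSum-mono-≤ a n λ j a≤j j<a+n → f≤g j a≤j (<-trans j<a+n (i+n<i+[1+n] a n)))

windowSum-+ : ∀ f g a n → windowSum (λ j → f j + g j) a n ≡ windowSum f a n + windowSum g a n
windowSum-+ f g a zero = refl
windowSum-+ f g a (suc n) = trans (cong (_+_ (f (a + + n) + g (a + + n))) (windowSum-+ f g a n))
  (x+y+[z+w]≡x+z+[y+w] (f (a + + n)) (g (a + + n)) (windowSum f a n) (windowSum g a n))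
  where
  x+y+[z+w]≡x+z+[y+w] : ∀ x y z w → x + y + (z + w) ≡ x + z + (y + w)
  x+y+[z+w]≡x+z+[y+w] = solve-∀

windowSum-zero : ∀ f a n → (∀ j → a ≤ j → j < a + + n → f j ≡ + 0) → windowSum f a n ≡ + 0
windowSum-zero f a n f≗0 = trans (windowSum-cong a n f≗0) (windowSum-const0 n)
  where
  windowSum-const0 : ∀ n → windowSum (λ _ → + 0) a n ≡ + 0
  windowSum-const0 zero = refl
  windowSum-const0 (suc n) = trans (+-identityˡ _) (windowSum-const0 n)

VanishesOutside : (ℤ → ℤ) → ℤ → ℕ → Set
VanishesOutside f a m = ∀ j → f j ≢ + 0 → a ≤ j × j < a + + m

vanishesOutside-< : ∀ {f a m} → VanishesOutside f a m → ∀ {j} → j < a → f j ≡ + 0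
vanishesOutside-< {f} v {j} j<a with f j ℤ.≟ + 0
... | yes fj≡0 = fj≡0
... | no fj≢0 = ⊥-elim (<⇒≱ j<a (proj₁ (v j fj≢0)))

vanishesOutside-≥ : ∀ {f a m} → VanishesOutside f a m → ∀ {j} → a + + m ≤ j → f j ≡ + 0
vanishesOutside-≥ {f} v {j} a+m≤j with f j ℤ.≟ + 0
... | yes fj≡0 = fj≡0
... | no fj≢0 = ⊥-elim (<⇒≱ (proj₂ (v j fj≢0)) a+m≤j)

windowSum-widen : ∀ {f a m lo len} → VanishesOutside f a m → lo ≤ a → a + + m ≤ lo + + len →
                  windowSum f lo len ≡ windowSum f a m
windowSum-widen {f} {a} {m} {lo} {len} v lo≤a a+m≤hi
  with i≤j⇒j≡i+n lo≤a | i≤j⇒j≡i+n a+m≤hi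
... | d , refl | e , hi≡ = begin
  windowSum f lo len
    ≡⟨ cong (windowSum f lo) len≡d+m+e ⟩
  windowSum f lo (d ℕ.+ m ℕ.+ e)
    ≡⟨ windowSum-++ f lo (d ℕ.+ m) e ⟩
  windowSum f lo (d ℕ.+ m) + windowSum f (lo + + (d ℕ.+ m)) e
    ≡⟨ cong₂ _+_ (windowSum-++ f lo d m) right≡0 ⟩
  windowSum f lo d + windowSum f (lo + + d) m + + 0
    ≡⟨ +-identityʳ _ ⟩
  windowSum f lo d + windowSum f (lo + + d) m
    ≡⟨ cong (_+ windowSum f (lo + + d) m) left≡0 ⟩
  + 0 + windowSum f (lo + + d) m
    ≡⟨ +-identityˡ _ ⟩
  windowSum f (lo + + d) m ∎
  where
  len≡d+m+e : len ≡ d ℕ.+ m ℕ.+ e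
  len≡d+m+e = +-offset-injective lo (trans hi≡ (trans (cong (_+ + e) (i+m+n≡i+[m+n] lo d m))
                                                      (i+m+n≡i+[m+n] lo (d ℕ.+ m) e)))
  left≡0 : windowSum f lo d ≡ + 0
  left≡0 = windowSum-zero f lo d λ j _ j<lo+d → vanishesOutside-< v j<lo+d
  right≡0 : windowSum f (lo + + (d ℕ.+ m)) e ≡ + 0
  right≡0 = windowSum-zero f _ e λ j lo+d+m≤j _ →
    vanishesOutside-≥ v (subst (_≤ j) (sym (i+m+n≡i+[m+n] lo d m)) lo+d+m≤j)

hull : ∀ a m b k → ∃ λ lo → ∃ λ len →
       lo ≤ a × lo ≤ b × a + + m ≤ lo + + len × b + + k ≤ lo + + len
hull a m b k
  with i≤j⇒j≡i+n (≤-trans (i⊓j≤i a b) (≤-trans (i≤i+n a m) (i≤i⊔j (a + + m) (b + + k))))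
... | len , hi≡ = a ℤ.⊓ b , len , i⊓j≤i a b , i⊓j≤j a b ,
  subst (a + + m ≤_) hi≡ (i≤i⊔j _ _) , subst (b + + k ≤_) hi≡ (i≤j⊔i _ _)

windowSum-irrelevant : ∀ {f a m b k} → VanishesOutside f a m → VanishesOutside f b k →
                       windowSum f a m ≡ windowSum f b k
windowSum-irrelevant {a = a} {m} {b} {k} va vb with hull a m b k
... | _ , _ , lo≤a , lo≤b , a+m≤hi , b+k≤hi =
  trans (sym (windowSum-widen va lo≤a a+m≤hi)) (windowSum-widen vb lo≤b b+k≤hi)

δ-refl : ∀ i → δ i i ≡ 1
δ-refl i with i ℤ.≟ i
... | yes _ = refl
... | no i≢i = ⊥-elim (i≢i refl)

δ-≢ : ∀ {i j} → i ≢ j → δ i j ≡ 0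
δ-≢ {i} {j} i≢j with i ℤ.≟ j
... | yes i≡j = ⊥-elim (i≢j i≡j)
... | no _ = refl

δ≢0⇒≡ : ∀ {i j} → δ i j ≢ 0 → i ≡ j
δ≢0⇒≡ {i} {j} δ≢0 with i ℤ.≟ j
... | yes i≡j = i≡j
... | no _ = ⊥-elim (δ≢0 refl)

windowSum-δ : ∀ {x a n} → a ≤ x → x < a + + n → windowSum (λ j → + δ x j) a n ≡ + 1
windowSum-δ {x} {a} {n} a≤x x<a+n = begin
  windowSum (λ j → + δ x j) a n  ≡⟨ windowSum-widen vanish a≤x (i<j⇒i+1≤j x<a+n) ⟩
  windowSum (λ j → + δ x j) x 1  ≡⟨ windowSum-1 (λ j → + δ x j) x ⟩
  + δ x x                        ≡⟨ cong (+_) (δ-refl x) ⟩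
  + 1                            ∎
  where
  vanish : VanishesOutside (λ j → + δ x j) x 1
  vanish j δ≢0 with δ≢0⇒≡ (δ≢0 ∘ cong (+_))
  ... | refl = ≤-refl , i<i+1 j

windowSum-δ-≤1 : ∀ x a n → windowSum (λ j → + δ x j) a n ≤ + 1
windowSum-δ-≤1 x a n with a ≤? x | x <? a + + n
... | yes a≤x | yes x<a+n = ≤-reflexive (windowSum-δ a≤x x<a+n)
... | no a≰x  | _         = ≤-trans (≤-reflexive (windowSum-zero _ a n λ j a≤j _ →
                               cong (+_) (δ-≢ λ { refl → a≰x a≤j }))) (+≤+ z≤n)
... | yes _   | no x≮a+n  = ≤-trans (≤-reflexive (windowSum-zero _ a n λ j _ j<a+n →
                               cong (+_) (δ-≢ λ { refl → x≮a+n j<a+n }))) (+≤+ z≤n)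


-- The rooms strictly between p and q; for q ≤ p the length ∣ q − p ∣ ∸ 1 is junk.
between : (ℤ → ℤ) → ℤ → ℤ → ℤ
between f p q = windowSum f (p + + 1) (ℤ.∣ q - p ∣ ℕ.∸ 1)

between-offset : ∀ f p n → between f p (p + + suc n) ≡ windowSum f (p + + 1) n
between-offset f p n = cong (λ d → windowSum f (p + + 1) (ℤ.∣ d ∣ ℕ.∸ 1)) (p+k-p≡k p (+ suc n))
  where
  p+k-p≡k : ∀ p k → p + k - p ≡ k
  p+k-p≡k = solve-∀

between-adjacent : ∀ f p → between f p (p + + 1) ≡ + 0
between-adjacent f p = between-offset f p 0

between-split : ∀ f {p x q} → p < x → x < q → between f p q ≡ between f p x + (f x + between f x q)
between-split f {p} p<x x<q with i<j⇒j≡i+1+n p<x | i<j⇒j≡i+1+n x<q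
... | m , refl | k , refl = begin
  between f p (p + + suc m + + suc k)
    ≡⟨ cong (between f p) (i+m+n≡i+[m+n] p (suc m) (suc k)) ⟩
  between f p (p + + suc (m ℕ.+ suc k))
    ≡⟨ between-offset f p (m ℕ.+ suc k) ⟩
  windowSum f (p + + 1) (m ℕ.+ suc k)
    ≡⟨ windowSum-++ f (p + + 1) m (suc k) ⟩
  windowSum f (p + + 1) m + windowSum f (p + + 1 + + m) (suc k)
    ≡⟨ cong₂ _+_ (sym (between-offset f p m)) (cong (λ x → windowSum f x (suc k)) (i+1+n≡i+[1+n] p m)) ⟩
  between f p (p + + suc m) + windowSum f (p + + suc m) (suc k)
    ≡⟨ cong (_+_ (between f p (p + + suc m))) (windowSum-suc f (p + + suc m) k) ⟩
  between f p (p + + suc m) + (f (p + + suc m) + windowSum f (p + + suc m + + 1) k)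
    ≡⟨ cong (λ s → between f p (p + + suc m) + (f (p + + suc m) + s))
            (sym (between-offset f (p + + suc m) k)) ⟩
  between f p (p + + suc m) + (f (p + + suc m) + between f (p + + suc m) (p + + suc m + + suc k)) ∎

between-snoc : ∀ f {p x} → p < x → between f p (x + + 1) ≡ between f p x + f x
between-snoc f {p} {x} p<x = begin
  between f p (x + + 1)
    ≡⟨ between-split f p<x (i<i+1 x) ⟩
  between f p x + (f x + between f x (x + + 1))
    ≡⟨ cong (λ s → between f p x + (f x + s)) (between-adjacent f x) ⟩
  between f p x + (f x + + 0)
    ≡⟨ cong (_+_ (between f p x)) (+-identityʳ (f x)) ⟩
  between f p x + f x ∎

between-cons : ∀ f {x q} → x + + 1 < q → between f x q ≡ f (x + + 1) + between f (x + + 1) q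
between-cons f {x} {q} x+1<q = begin
  between f x q                                          ≡⟨ between-split f (i<i+1 x) x+1<q ⟩
  between f x (x + + 1) + (f (x + + 1) + between f (x + + 1) q)
    ≡⟨ cong (_+ (f (x + + 1) + between f (x + + 1) q)) (between-adjacent f x) ⟩
  + 0 + (f (x + + 1) + between f (x + + 1) q)            ≡⟨ +-identityˡ _ ⟩
  f (x + + 1) + between f (x + + 1) q                    ∎

between-cons₂ : ∀ f {x q} → x + + 2 < q →
                between f x q ≡ f (x + + 1) + (f (x + + 2) + between f (x + + 2) q)
between-cons₂ f {x} {q} x+2<q = begin
  between f x q
    ≡⟨ between-cons f (<-trans (subst (x + + 1 <_) (i+1+1≡i+2 x) (i<i+1 (x + + 1))) x+2<q) ⟩
  f (x + + 1) + between f (x + + 1) q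
    ≡⟨ cong (_+_ (f (x + + 1))) (between-cons f (subst (_< q) (sym (i+1+1≡i+2 x)) x+2<q)) ⟩
  f (x + + 1) + (f (x + + 1 + + 1) + between f (x + + 1 + + 1) q)
    ≡⟨ cong (λ y → f (x + + 1) + (f y + between f y q)) (i+1+1≡i+2 x) ⟩
  f (x + + 1) + (f (x + + 2) + between f (x + + 2) q) ∎

between-mono-≤ : ∀ {f g p q} → p < q → (∀ j → p < j → j < q → f j ≤ g j) →
                 between f p q ≤ between g p q
between-mono-≤ {f} {g} {p} p<q f≤g with i<j⇒j≡i+1+n p<q
... | n , refl = subst₂ _≤_ (sym (between-offset f p n)) (sym (between-offset g p n))
  (windowSum-mono-≤ (p + + 1) n λ j p+1≤j j<p+1+n →
    f≤g j (i+1≤j⇒i<j p+1≤j) (subst (j <_) (i+1+n≡i+[1+n] p n) j<p+1+n))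

between-cong : ∀ {f g p q} → p < q → (∀ j → p < j → j < q → f j ≡ g j) →
               between f p q ≡ between g p q
between-cong p<q f≗g = ≤-antisym (between-mono-≤ p<q λ j p<j j<q → ≤-reflexive (f≗g j p<j j<q))
                                 (between-mono-≤ p<q λ j p<j j<q → ≤-reflexive (sym (f≗g j p<j j<q)))

between-nonneg : ∀ {f p q} → p < q → (∀ j → p < j → j < q → + 0 ≤ f j) → + 0 ≤ between f p q
between-nonneg {f} {p} {q} p<q 0≤f = subst (_≤ between f p q) zero≡0 (between-mono-≤ p<q 0≤f)
  where
  zero≡0 : between (λ _ → + 0) p q ≡ + 0
  zero≡0 = windowSum-zero _ (p + + 1) (ℤ.∣ q - p ∣ ℕ.∸ 1) λ _ _ _ → refl

between-+ : ∀ f g p q → between (λ j → f j + g j) p q ≡ between f p q + between g p q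
between-+ f g p q = windowSum-+ f g (p + + 1) (ℤ.∣ q - p ∣ ℕ.∸ 1)

between-δ-≤1 : ∀ x p q → between (λ j → + δ x j) p q ≤ + 1
between-δ-≤1 x p q = windowSum-δ-≤1 x (p + + 1) (ℤ.∣ q - p ∣ ℕ.∸ 1)


occupied? : ∀ S → Decidable (Occupied S)
occupied? S j = 0 ℕ.<? occ S j

¬occupied⇒empty : ∀ {S j} → ¬ Occupied S j → occ S j ≡ 0
¬occupied⇒empty {S} {j} ¬occ with occ S j
... | zero  = refl
... | suc _ = ⊥-elim (¬occ (s≤s z≤n))

empty⇒¬occupied : ∀ {S j} → occ S j ≡ 0 → ¬ Occupied S j
empty⇒¬occupied empty occupied = ℕ.<⇒≢ occupied (sym empty)

≡1⇒≱2 : ∀ {n} → n ≡ 1 → ¬ (2 ℕ.≤ n)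
≡1⇒≱2 refl (s≤s ())

vanishesOutside-state : ∀ S {f} → (∀ j → occ S j ≡ 0 → f j ≡ + 0) → VanishesOutside f (lo S) (len S)
vanishesOutside-state S f0 j fj≢0 = support S j λ empty → fj≢0 (f0 j empty)

occupied⇒inWindow : ∀ S {j} → Occupied S j → lo S ≤ j × j < lo S + + len S
occupied⇒inWindow S {j} occupied = support S j λ empty → empty⇒¬occupied {S} empty occupied

windowSum-state : ∀ U {f a n} → (∀ j → occ U j ≡ 0 → f j ≡ + 0) →
                  (∀ j → Occupied U j → a ≤ j × j < a + + n) →
                  windowSum f (lo U) (len U) ≡ windowSum f a n
windowSum-state U f0 inside =
  windowSum-irrelevant (vanishesOutside-state U f0) λ j fj≢0 → inside j (ℕ.n≢0⇒n>0 (fj≢0 ∘ f0 j))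

size-window : ∀ U {a n} → (∀ j → Occupied U j → a ≤ j × j < a + + n) →
              size U ≡ ℤ.∣ windowSum (λ j → + occ U j) a n ∣
size-window U inside = cong ℤ.∣_∣ (windowSum-state U (λ _ → cong (+_)) inside)

moment-window : ∀ U {a n} → (∀ j → Occupied U j → a ≤ j × j < a + + n) →
                moment U ≡ windowSum (λ j → + occ U j * j) a n
moment-window U inside = windowSum-state U (λ j empty → cong (λ k → + k * j) empty) inside

windowSum-occ+δ+δ : ∀ U {x y a n} → a ≤ x × x < a + + n → a ≤ y × y < a + + n →
  windowSum (λ j → + (occ U j ℕ.+ δ x j ℕ.+ δ y j)) a n ≡ windowSum (λ j → + occ U j) a n + + 1 + + 1
windowSum-occ+δ+δ U {x} {y} {a} {n} (a≤x , x<a+n) (a≤y , y<a+n) = begin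
  windowSum (λ j → + (occ U j ℕ.+ δ x j ℕ.+ δ y j)) a n
    ≡⟨ windowSum-cong a n (λ j _ _ → lift j) ⟩
  windowSum (λ j → + occ U j + + δ x j + + δ y j) a n
    ≡⟨ windowSum-+ _ (λ j → + δ y j) a n ⟩
  windowSum (λ j → + occ U j + + δ x j) a n + windowSum (λ j → + δ y j) a n
    ≡⟨ cong₂ _+_ (windowSum-+ (λ j → + occ U j) (λ j → + δ x j) a n) (windowSum-δ a≤y y<a+n) ⟩
  windowSum (λ j → + occ U j) a n + windowSum (λ j → + δ x j) a n + + 1
    ≡⟨ cong (λ s → windowSum (λ j → + occ U j) a n + s + + 1) (windowSum-δ a≤x x<a+n) ⟩
  windowSum (λ j → + occ U j) a n + + 1 + + 1 ∎
  where
  lift : ∀ j → + (occ U j ℕ.+ δ x j ℕ.+ δ y j) ≡ + occ U j + + δ x j + + δ y j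
  lift j = trans (pos-+ (occ U j ℕ.+ δ x j) (δ y j)) (cong (_+ + δ y j) (pos-+ (occ U j) (δ x j)))

final⇒¬adjacent : ∀ {U j} → Final U → Occupied U j → ¬ Occupied U (j + + 1)
final⇒¬adjacent final occupied-j occupied-j+1 = final (_ , occupied-j , occupied-j+1)


-- Weights and the two invariants

weight : ℕ → ℤ
weight zero    = -1ℤ
weight (suc n) = + suc n

-1≤weight : ∀ n → -1ℤ ≤ weight n
-1≤weight zero    = ≤-refl
-1≤weight (suc n) = -≤+

1≤weight : ∀ {n} → 0 ℕ.< n → + 1 ≤ weight n
1≤weight {suc n} _ = +≤+ (s≤s z≤n)

weightOf : State → ℤ → ℤ
weightOf S = weight ∘ occ S

Flanked : State → Set
Flanked S = ∀ j → 2 ℕ.≤ occ S j → Occupied S (j - + 1) ⊎ Occupied S (j + + 1)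

GapBounded : State → Set
GapBounded S = ∀ {p q} → p < q → Occupied S p → Occupied S q →
               - + 2 ≤ between (weightOf S) p q

DoubleGap : State → ℤ → Set
DoubleGap U x = Occupied U x × occ U (x + + 1) ≡ 0 × occ U (x + + 2) ≡ 0 × Occupied U (x + + 3)


-- A single move

module MoveAnatomy
  (S T : State) (i l r : ℤ)
  (occupied-i : Occupied S i) (occupied-i+1 : Occupied S (i + + 1))
  (l<i : l < i) (empty-l : occ S l ≡ 0) (occupied-l⋯i : ∀ k → l < k → k < i → Occupied S k)
  (i+1<r : i + + 1 < r) (empty-r : occ S r ≡ 0)
  (occupied-i+1⋯r : ∀ k → i + + 1 < k → k < r → Occupied S k)
  (transfer : ∀ j → occ T j ℕ.+ δ i j ℕ.+ δ (i + + 1) j ≡ occ S j ℕ.+ δ l j ℕ.+ δ r j)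
  where

  l<i+1 : l < i + + 1
  l<i+1 = <-trans l<i (i<i+1 i)

  i<r : i < r
  i<r = <-trans (i<i+1 i) i+1<r

  l<r : l < r
  l<r = <-trans l<i i<r

  transfer-at : ∀ j {a b c d} → δ i j ≡ a → δ (i + + 1) j ≡ b → δ l j ≡ c → δ r j ≡ d →
                occ T j ℕ.+ a ℕ.+ b ≡ occ S j ℕ.+ c ℕ.+ d
  transfer-at j refl refl refl refl = transfer j

  n+0+0≡n : ∀ n → n ℕ.+ 0 ℕ.+ 0 ≡ n
  n+0+0≡n n = trans (ℕ.+-identityʳ _) (ℕ.+-identityʳ n)

  occT-l : occ T l ≡ 1
  occT-l = begin
    occ T l                ≡⟨ n+0+0≡n (occ T l) ⟨
    occ T l ℕ.+ 0 ℕ.+ 0    ≡⟨ transfer-at l (δ-≢ (<⇒≢ l<i ∘ sym)) (δ-≢ (<⇒≢ l<i+1 ∘ sym))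
                                            (δ-refl l) (δ-≢ (<⇒≢ l<r ∘ sym)) ⟩
    occ S l ℕ.+ 1 ℕ.+ 0    ≡⟨ cong (λ n → n ℕ.+ 1 ℕ.+ 0) empty-l ⟩
    1                      ∎

  occT-r : occ T r ≡ 1
  occT-r = begin
    occ T r                ≡⟨ n+0+0≡n (occ T r) ⟨
    occ T r ℕ.+ 0 ℕ.+ 0    ≡⟨ transfer-at r (δ-≢ (<⇒≢ i<r)) (δ-≢ (<⇒≢ i+1<r))
                                            (δ-≢ (<⇒≢ l<r)) (δ-refl r) ⟩
    occ S r ℕ.+ 0 ℕ.+ 1    ≡⟨ cong (λ n → n ℕ.+ 0 ℕ.+ 1) empty-r ⟩
    1                      ∎


  occS≤occT : ∀ {j} → j ≢ i → j ≢ i + + 1 → occ S j ℕ.≤ occ T j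
  occS≤occT {j} j≢i j≢i+1 =
    subst (occ S j ℕ.≤_) gained (ℕ.≤-trans (ℕ.m≤m+n (occ S j) (δ l j)) (ℕ.m≤m+n _ (δ r j)))
    where
    gained : occ S j ℕ.+ δ l j ℕ.+ δ r j ≡ occ T j
    gained = trans (sym (transfer-at j (δ-≢ (j≢i ∘ sym)) (δ-≢ (j≢i+1 ∘ sym)) refl refl))
                   (n+0+0≡n (occ T j))

  occT≤occS : ∀ {j} → j ≢ l → j ≢ r → occ T j ℕ.≤ occ S j
  occT≤occS {j} j≢l j≢r =
    subst (occ T j ℕ.≤_) lost (ℕ.≤-trans (ℕ.m≤m+n (occ T j) (δ i j)) (ℕ.m≤m+n _ (δ (i + + 1) j)))
    where
    lost : occ T j ℕ.+ δ i j ℕ.+ δ (i + + 1) j ≡ occ S j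
    lost = trans (transfer-at j refl refl (δ-≢ (j≢l ∘ sym)) (δ-≢ (j≢r ∘ sym))) (n+0+0≡n (occ S j))

  occupiedS⇒occupiedT : ∀ {j} → j ≢ i → j ≢ i + + 1 → Occupied S j → Occupied T j
  occupiedS⇒occupiedT j≢i j≢i+1 occupied = ℕ.<-≤-trans occupied (occS≤occT j≢i j≢i+1)

  occupiedT⇒occupiedS : ∀ {j} → j ≢ l → j ≢ r → Occupied T j → Occupied S j
  occupiedT⇒occupiedS j≢l j≢r occupied = ℕ.<-≤-trans occupied (occT≤occS j≢l j≢r)

  occT≡occS : ∀ {j} → j ≢ i → j ≢ i + + 1 → j ≢ l → j ≢ r → occ T j ≡ occ S j
  occT≡occS j≢i j≢i+1 j≢l j≢r = ℕ.≤-antisym (occT≤occS j≢l j≢r) (occS≤occT j≢i j≢i+1)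

  occT≡occS-left : ∀ {j} → j < l → occ T j ≡ occ S j
  occT≡occS-left j<l =
    occT≡occS (<⇒≢ (<-trans j<l l<i)) (<⇒≢ (<-trans j<l l<i+1)) (<⇒≢ j<l) (<⇒≢ (<-trans j<l l<r))

  occT≡occS-right : ∀ {j} → r < j → occ T j ≡ occ S j
  occT≡occS-right r<j = occT≡occS (<⇒≢ (<-trans i<r r<j) ∘ sym) (<⇒≢ (<-trans i+1<r r<j) ∘ sym)
                                   (<⇒≢ (<-trans l<r r<j) ∘ sym) (<⇒≢ r<j ∘ sym)

  occupiedT-l : Occupied T l
  occupiedT-l = subst (0 ℕ.<_) (sym occT-l) (s≤s z≤n)

  occupiedT-r : Occupied T r
  occupiedT-r = subst (0 ℕ.<_) (sym occT-r) (s≤s z≤n)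

  occupiedT-l⋯i : ∀ {k} → l ≤ k → k < i → Occupied T k
  occupiedT-l⋯i {k} l≤k k<i with k ℤ.≟ l
  ... | yes refl = occupiedT-l
  ... | no k≢l   = occupiedS⇒occupiedT (<⇒≢ k<i) (<⇒≢ (<-trans k<i (i<i+1 i)))
                     (occupied-l⋯i k (≤∧≢⇒< l≤k (k≢l ∘ sym)) k<i)

  occupiedT-i+1⋯r : ∀ {k} → i + + 1 < k → k ≤ r → Occupied T k
  occupiedT-i+1⋯r {k} i+1<k k≤r with k ℤ.≟ r
  ... | yes refl = occupiedT-r
  ... | no k≢r   = occupiedS⇒occupiedT (<⇒≢ (<-trans (i<i+1 i) i+1<k) ∘ sym) (<⇒≢ i+1<k ∘ sym)
                     (occupied-i+1⋯r k i+1<k (≤∧≢⇒< k≤r k≢r))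

  occupiedT-l⋯r : ∀ {k} → l ≤ k → k ≤ r → k ≢ i → k ≢ i + + 1 → Occupied T k
  occupiedT-l⋯r {k} l≤k k≤r k≢i k≢i+1 with <-cmp k i
  ... | tri< k<i _ _ = occupiedT-l⋯i l≤k k<i
  ... | tri≈ _ k≡i _ = ⊥-elim (k≢i k≡i)
  ... | tri> _ _ i<k = occupiedT-i+1⋯r (≤∧≢⇒< (i<j⇒i+1≤j i<k) (k≢i+1 ∘ sym)) k≤r

  size≡ : size T ≡ size S
  size≡ with hull (lo S) (len S) (lo T) (len T)
  ... | a , n , a≤loS , a≤loT , hiS≤ , hiT≤ = begin
    size T                                 ≡⟨ size-window T inWindowT ⟩
    ℤ.∣ windowSum (λ j → + occ T j) a n ∣  ≡⟨ cong ℤ.∣_∣ sums≡ ⟩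
    ℤ.∣ windowSum (λ j → + occ S j) a n ∣  ≡⟨ size-window S inWindowS ⟨
    size S                                 ∎
    where
    inWindowS : ∀ x → Occupied S x → a ≤ x × x < a + + n
    inWindowS x occupied with occupied⇒inWindow S occupied
    ... | loS≤x , x<hiS = ≤-trans a≤loS loS≤x , <-≤-trans x<hiS hiS≤
    inWindowT : ∀ x → Occupied T x → a ≤ x × x < a + + n
    inWindowT x occupied with occupied⇒inWindow T occupied
    ... | loT≤x , x<hiT = ≤-trans a≤loT loT≤x , <-≤-trans x<hiT hiT≤
    sums≡ : windowSum (λ j → + occ T j) a n ≡ windowSum (λ j → + occ S j) a n
    sums≡ = +-cancelʳ-≡ (+ 1) _ _ (+-cancelʳ-≡ (+ 1) _ _ balance)
      where
      balance : windowSum (λ j → + occ T j) a n + + 1 + + 1 ≡ windowSum (λ j → + occ S j) a n + + 1 + + 1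
      balance = begin
        windowSum (λ j → + occ T j) a n + + 1 + + 1
          ≡⟨ windowSum-occ+δ+δ T (inWindowS i occupied-i) (inWindowS (i + + 1) occupied-i+1) ⟨
        windowSum (λ j → + (occ T j ℕ.+ δ i j ℕ.+ δ (i + + 1) j)) a n
          ≡⟨ windowSum-cong a n (λ j _ _ → cong (+_) (transfer j)) ⟩
        windowSum (λ j → + (occ S j ℕ.+ δ l j ℕ.+ δ r j)) a n
          ≡⟨ windowSum-occ+δ+δ S (inWindowT l occupiedT-l) (inWindowT r occupiedT-r) ⟩
        windowSum (λ j → + occ S j) a n + + 1 + + 1 ∎

  occupiedS⇒occupiedT-<i : ∀ {k} → k < i → Occupied S k → Occupied T k
  occupiedS⇒occupiedT-<i k<i = occupiedS⇒occupiedT (<⇒≢ k<i) (<⇒≢ (<-trans k<i (i<i+1 i)))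

  occupiedS⇒occupiedT->i+1 : ∀ {k} → i + + 1 < k → Occupied S k → Occupied T k
  occupiedS⇒occupiedT->i+1 i+1<k =
    occupiedS⇒occupiedT (<⇒≢ (<-trans (i<i+1 i) i+1<k) ∘ sym) (<⇒≢ i+1<k ∘ sym)

  flanked : Flanked S → Flanked T
  flanked flankedS j crowded with <-cmp j l | <-cmp j r
  ... | tri< j<l _ _ | _ = Sum.map
        (occupiedS⇒occupiedT-<i (<-trans (<-trans (i-1<i j) j<l) l<i))
        (occupiedS⇒occupiedT-<i (≤-<-trans (i<j⇒i+1≤j j<l) l<i))
        (flankedS j (subst (2 ℕ.≤_) (occT≡occS-left j<l) crowded))
  ... | tri≈ _ refl _ | _ = ⊥-elim (≡1⇒≱2 occT-l crowded)
  ... | _ | tri≈ _ refl _ = ⊥-elim (≡1⇒≱2 occT-r crowded)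
  ... | _ | tri> _ _ r<j = Sum.map
        (occupiedS⇒occupiedT->i+1 (<-≤-trans i+1<r (i<j⇒i≤j-1 r<j)))
        (occupiedS⇒occupiedT->i+1 (<-trans (<-trans i+1<r r<j) (i<i+1 j)))
        (flankedS j (subst (2 ℕ.≤_) (occT≡occS-right r<j) crowded))
  ... | tri> _ _ l<j | tri< j<r _ _ with j ≤? i
  ...   | yes j≤i = inj₁ (occupiedT-l⋯i (i<j⇒i≤j-1 l<j) (<-≤-trans (i-1<i j) j≤i))
  ...   | no j≰i  = inj₂ (occupiedT-i+1⋯r (+-monoˡ-< (+ 1) (≰⇒> j≰i)) (i<j⇒i+1≤j j<r))

  weightT-l : weightOf T l ≡ + 1
  weightT-l = cong weight occT-l

  weightT-r : weightOf T r ≡ + 1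
  weightT-r = cong weight occT-r

  -- Apart from i and i + 1, every room of (l, r) is occupied in T; the δ terms pay for those two.
  0≤weightT+δ+δ : ∀ j → l < j → j < r → + 0 ≤ weightOf T j + (+ δ i j + + δ (i + + 1) j)
  0≤weightT+δ+δ j l<j j<r with j ℤ.≟ i | j ℤ.≟ i + + 1
  ... | yes refl | _ rewrite δ-refl j =
    +-mono-≤ (-1≤weight (occ T j)) (+-mono-≤ (≤-refl {+ 1}) (0≤+n (δ (j + + 1) j)))
  ... | no _ | yes refl rewrite δ-refl j =
    +-mono-≤ (-1≤weight (occ T j)) (+-mono-≤ (0≤+n (δ i j)) (≤-refl {+ 1}))
  ... | no j≢i | no j≢i+1 =
    +-mono-≤ (≤-trans (0≤+n 1) (1≤weight (occupiedT-l⋯r (<⇒≤ l<j) (<⇒≤ j<r) j≢i j≢i+1)))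
             (+-mono-≤ (0≤+n (δ i j)) (0≤+n (δ (i + + 1) j)))

  core : ∀ {p q} → l ≤ p → q ≤ r → p < q → - + 2 ≤ between (weightOf T) p q
  core {p} {q} l≤p q≤r p<q = 0≤x+[a+b]⇒-2≤x (subst (+ 0 ≤_) split nonneg)
    (between-δ-≤1 i p q) (between-δ-≤1 (i + + 1) p q)
    where
    nonneg : + 0 ≤ between (λ j → weightOf T j + (+ δ i j + + δ (i + + 1) j)) p q
    nonneg = between-nonneg p<q λ j p<j j<q → 0≤weightT+δ+δ j (≤-<-trans l≤p p<j) (<-≤-trans j<q q≤r)
    split : between (λ j → weightOf T j + (+ δ i j + + δ (i + + 1) j)) p q
          ≡ between (weightOf T) p q + (between (λ j → + δ i j) p q + between (λ j → + δ (i + + 1) j) p q)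
    split = trans (between-+ (weightOf T) _ p q) (cong (_+_ (between (weightOf T) p q)) (between-+ _ _ p q))

  module _ (gapS : GapBounded S) where

    left-slack : ∀ {p} → p < l → Occupied S p → -1ℤ ≤ between (weightOf S) p l
    left-slack {p} p<l occupied-p =
      -2≤x-1⇒-1≤x (subst (- + 2 ≤_) snoc-l (gapS (<-trans p<l (i<i+1 l)) occupied-p occupied-l+1))
      where
      snoc-l : between (weightOf S) p (l + + 1) ≡ between (weightOf S) p l - + 1
      snoc-l = trans (between-snoc _ p<l) (cong (λ n → between (weightOf S) p l + weight n) empty-l)
      occupied-l+1 : Occupied S (l + + 1)
      occupied-l+1 with l + + 1 ℤ.≟ i
      ... | yes l+1≡i = subst (Occupied S) (sym l+1≡i) occupied-i
      ... | no l+1≢i  = occupied-l⋯i _ (i<i+1 l) (≤∧≢⇒< (i<j⇒i+1≤j l<i) l+1≢i)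

    right-slack : ∀ {q} → r < q → Occupied S q → -1ℤ ≤ between (weightOf S) r q
    right-slack {q} r<q occupied-q =
      -2≤x-1⇒-1≤x (subst (- + 2 ≤_) cons-r (gapS (<-trans (i-1<i r) r<q) occupied-r-1 occupied-q))
      where
      cons-r : between (weightOf S) (r - + 1) q ≡ between (weightOf S) r q - + 1
      cons-r = begin
        between (weightOf S) (r - + 1) q
          ≡⟨ between-split _ (i-1<i r) r<q ⟩
        between (weightOf S) (r - + 1) r + (weight (occ S r) + between (weightOf S) r q)
          ≡⟨ cong₂ (λ b n → b + (weight n + between (weightOf S) r q))
               (trans (cong (between (weightOf S) (r - + 1)) (sym (i-1+1≡i r)))
                      (between-adjacent _ (r - + 1)))
               empty-r ⟩
        + 0 + (-1ℤ + between (weightOf S) r q)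
          ≡⟨ 0+[-1+x]≡x-1 (between (weightOf S) r q) ⟩
        between (weightOf S) r q - + 1 ∎
        where
        0+[-1+x]≡x-1 : ∀ x → + 0 + (-1ℤ + x) ≡ x - + 1
        0+[-1+x]≡x-1 = solve-∀
      occupied-r-1 : Occupied S (r - + 1)
      occupied-r-1 with r - + 1 ℤ.≟ i + + 1
      ... | yes r-1≡i+1 = subst (Occupied S) (sym r-1≡i+1) occupied-i+1
      ... | no r-1≢i+1  = occupied-i+1⋯r _ (≤∧≢⇒< (i<j⇒i≤j-1 i+1<r) (r-1≢i+1 ∘ sym)) (i-1<i r)

    up-to-r : ∀ {p q} → l ≤ p → p < r → p < q → Occupied T q → - + 2 ≤ between (weightOf T) p q
    up-to-r {p} {q} l≤p p<r p<q occupied-q with q ≤? r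
    ... | yes q≤r = core l≤p q≤r p<q
    ... | no q≰r = subst (- + 2 ≤_) (sym (between-split _ p<r r<q))
                     (+-mono-≤ (core l≤p ≤-refl p<r) (+-mono-≤ (≤-reflexive (sym weightT-r)) right-part))
      where
      r<q : r < q
      r<q = ≰⇒> q≰r
      right-part : -1ℤ ≤ between (weightOf T) r q
      right-part = subst (-1ℤ ≤_) (between-cong r<q λ j r<j _ → cong weight (sym (occT≡occS-right r<j)))
        (right-slack r<q (occupiedT⇒occupiedS (<⇒≢ (<-trans l<r r<q) ∘ sym) (<⇒≢ r<q ∘ sym) occupied-q))

    across-l : ∀ {p q} → p < l → l < q → Occupied T p → Occupied T q → - + 2 ≤ between (weightOf T) p q
    across-l {p} {q} p<l l<q occupied-p occupied-q = subst (- + 2 ≤_) (sym (between-split _ p<l l<q))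
      (+-mono-≤ left-part (+-mono-≤ (≤-reflexive (sym weightT-l)) (up-to-r ≤-refl l<r l<q occupied-q)))
      where
      left-part : -1ℤ ≤ between (weightOf T) p l
      left-part = subst (-1ℤ ≤_) (between-cong p<l λ j _ j<l → cong weight (sym (occT≡occS-left j<l)))
        (left-slack p<l (occupiedT⇒occupiedS (<⇒≢ p<l) (<⇒≢ (<-trans p<l l<r)) occupied-p))

    left-of-l : ∀ {p q} → p < q → q ≤ l → Occupied T p → Occupied T q →
                - + 2 ≤ between (weightOf T) p q
    left-of-l {p} {q} p<q q≤l occupied-p occupied-q =
      subst (- + 2 ≤_) (between-cong p<q λ j _ j<q → cong weight (sym (occT≡occS-left (<-≤-trans j<q q≤l))))
        boundS
      where
      occupiedS-p : Occupied S p
      occupiedS-p = occupiedT⇒occupiedS (<⇒≢ p<l) (<⇒≢ (<-trans p<l l<r)) occupied-p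
        where p<l = <-≤-trans p<q q≤l
      boundS : - + 2 ≤ between (weightOf S) p q
      boundS with q ℤ.≟ l
      ... | yes refl = ≤-trans (-≤- z≤n) (left-slack p<q occupiedS-p)
      ... | no q≢l   = gapS p<q occupiedS-p (occupiedT⇒occupiedS q≢l (<⇒≢ (≤-<-trans q≤l l<r)) occupied-q)

    right-of-r : ∀ {p q} → p < q → r ≤ p → Occupied T p → Occupied T q →
                 - + 2 ≤ between (weightOf T) p q
    right-of-r {p} {q} p<q r≤p occupied-p occupied-q =
      subst (- + 2 ≤_) (between-cong p<q λ j p<j _ → cong weight (sym (occT≡occS-right (≤-<-trans r≤p p<j))))
        boundS
      where
      r<q : r < q
      r<q = ≤-<-trans r≤p p<q
      occupiedS-q : Occupied S q
      occupiedS-q = occupiedT⇒occupiedS (<⇒≢ (<-trans l<r r<q) ∘ sym) (<⇒≢ r<q ∘ sym) occupied-q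
      boundS : - + 2 ≤ between (weightOf S) p q
      boundS with p ℤ.≟ r
      ... | yes refl = ≤-trans (-≤- z≤n) (right-slack p<q occupiedS-q)
      ... | no p≢r   =
        gapS p<q (occupiedT⇒occupiedS (<⇒≢ (<-≤-trans l<r r≤p) ∘ sym) p≢r occupied-p) occupiedS-q

    gapBounded : GapBounded T
    gapBounded {p} {q} p<q occupied-p occupied-q with p <? l | q ≤? l | p <? r
    ... | yes p<l | yes q≤l | _       = left-of-l p<q q≤l occupied-p occupied-q
    ... | yes p<l | no q≰l  | _       = across-l p<l (≰⇒> q≰l) occupied-p occupied-q
    ... | no p≮l  | _       | yes p<r = up-to-r (≮⇒≥ p≮l) p<r p<q occupied-q
    ... | no p≮l  | _       | no p≮r  = right-of-r p<q (≮⇒≥ p≮r) occupied-p occupied-q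

  -- If T is final, no occupied room sits next to l or r, which pins l = i − 1 and r = i + 2.
  final⇒doubleGap : Final T → DoubleGap T l
  final⇒doubleGap final =
    occupiedT-l ,
    ¬occupied⇒empty {T} (final⇒¬adjacent {T} final occupiedT-l) ,
    ¬occupied⇒empty {T} (λ occupied-l+2 → final⇒¬adjacent {T} final
      (subst (Occupied T) (trans (sym (i+1+1≡i+2 l)) (cong (_+ + 1) l+1≡i)) occupied-l+2)
      (subst (Occupied T) r≡i+1+1 occupiedT-r)) ,
    subst (Occupied T) (trans r≡i+1+1 (trans (cong (λ k → k + + 1 + + 1) (sym l+1≡i)) (i+1+1+1≡i+3 l)))
      occupiedT-r
    where
    l+1≡i : l + + 1 ≡ i
    l+1≡i with l + + 1 ℤ.≟ i
    ... | yes l+1≡i = l+1≡i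
    ... | no l+1≢i  = ⊥-elim (final⇒¬adjacent {T} final occupiedT-l
                        (occupiedT-l⋯i (i≤i+n l 1) (≤∧≢⇒< (i<j⇒i+1≤j l<i) l+1≢i)))
    r≡i+1+1 : r ≡ i + + 1 + + 1
    r≡i+1+1 with r ℤ.≟ i + + 1 + + 1
    ... | yes r≡i+1+1 = r≡i+1+1
    ... | no r≢i+1+1  = ⊥-elim (final⇒¬adjacent {T} final
           (occupiedT-i+1⋯r (i+1≤j⇒i<j (i<j⇒i≤j-1 (≤∧≢⇒< (i<j⇒i+1≤j i+1<r) (r≢i+1+1 ∘ sym))))
                            (<⇒≤ (i-1<i r)))
           (subst (Occupied T) (sym (i-1+1≡i r)) occupiedT-r))

Move⇒size≡ : ∀ {S T} → Move S T → size T ≡ size S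
Move⇒size≡ {S} {T} (i , l , r , a , b , c , d , e , f , g , h , k) =
  MoveAnatomy.size≡ S T i l r a b c d e f g h k

Move⇒flanked : ∀ {S T} → Move S T → Flanked S → Flanked T
Move⇒flanked {S} {T} (i , l , r , a , b , c , d , e , f , g , h , k) =
  MoveAnatomy.flanked S T i l r a b c d e f g h k

Move⇒gapBounded : ∀ {S T} → Move S T → GapBounded S → GapBounded T
Move⇒gapBounded {S} {T} (i , l , r , a , b , c , d , e , f , g , h , k) =
  MoveAnatomy.gapBounded S T i l r a b c d e f g h k

Move⇒final⇒doubleGap : ∀ {S T} → Move S T → Final T → ∃ (DoubleGap T)
Move⇒final⇒doubleGap {S} {T} (i , l , r , a , b , c , d , e , f , g , h , k) final =
  l , MoveAnatomy.final⇒doubleGap S T i l r a b c d e f g h k final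

Move⇒¬final : ∀ {S T} → Move S T → ¬ Final S
Move⇒¬final (i , _ , _ , occupied-i , occupied-i+1 , _) finalS = finalS (i , occupied-i , occupied-i+1)


Reachable-preserves : (P : State → Set) → (∀ {S T} → Move S T → P S → P T) →
                      ∀ {S U} → Reachable S U → P S → P U
Reachable-preserves P preserves done       PS = PS
Reachable-preserves P preserves (step m r) PS = Reachable-preserves P preserves r (preserves m PS)

Reachable⇒size≡ : ∀ {C S} → Reachable C S → size S ≡ size C
Reachable⇒size≡ {C} reach =
  Reachable-preserves (λ T → size T ≡ size C)
    (λ {S} {T} m size≡ → trans (Move⇒size≡ {S} {T} m) size≡) reach refl

Reachable⇒final⇒doubleGap : ∀ {S U} → Reachable S U → ¬ Final S → Final U → ∃ (DoubleGap U)
Reachable⇒final⇒doubleGap done                 ¬finalS finalU = ⊥-elim (¬finalS finalU)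
Reachable⇒final⇒doubleGap {S} {U} (step m done) _ finalU = Move⇒final⇒doubleGap {S} {U} m finalU
Reachable⇒final⇒doubleGap (step {T = T} m r@(step {T = T′} m′ _)) _ finalU =
  Reachable⇒final⇒doubleGap r (Move⇒¬final {T} {T′} m′) finalU

Reachable-from-stuck : ∀ {S U} → (∀ T → ¬ Move S T) → Reachable S U → U ≡ S
Reachable-from-stuck stuck done                 = refl
Reachable-from-stuck stuck (step {T = T} m _)   = ⊥-elim (stuck T m)


OccupiesExactly : State → ℤ → ℤ → Set
OccupiesExactly C L U = ∀ i → (Occupied C i → L ≤ i × i ≤ U) × (L ≤ i × i ≤ U → Occupied C i)

interval-flanked : ∀ {C L U} → L < U → OccupiesExactly C L U → Flanked C
interval-flanked {C} {L} {U} L<U exact j crowded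
  with proj₁ (exact j) (ℕ.<-≤-trans (s≤s z≤n) crowded) | j <? U
... | L≤j , _   | yes j<U = inj₂ (proj₂ (exact _) (≤-trans L≤j (<⇒≤ (i<i+1 j)) , i<j⇒i+1≤j j<U))
... | _ , j≤U   | no j≮U  =
  inj₁ (proj₂ (exact _) (i<j⇒i≤j-1 (<-≤-trans L<U (≮⇒≥ j≮U)) , ≤-trans (<⇒≤ (i-1<i j)) j≤U))

interval-gapBounded : ∀ {C L U} → OccupiesExactly C L U → GapBounded C
interval-gapBounded {C} exact {p} {q} p<q occupied-p occupied-q =
  ≤-trans -≤+ (between-nonneg p<q λ j p<j j<q → ≤-trans (0≤+n 1) (1≤weight (proj₂ (exact j)
    (≤-trans (proj₁ (proj₁ (exact p) occupied-p)) (<⇒≤ p<j) ,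
     ≤-trans (<⇒≤ j<q) (proj₂ (proj₁ (exact q) occupied-q))))))

interval-¬final : ∀ {C L U} → L < U → OccupiesExactly C L U → ¬ Final C
interval-¬final L<U exact final =
  final (_ , proj₂ (exact _) (≤-refl , <⇒≤ L<U) , proj₂ (exact _) (<⇒≤ (i<i+1 _) , i<j⇒i+1≤j L<U))

singleton-stuck : ∀ {C x} → OccupiesExactly C x x → ∀ T → ¬ Move C T
singleton-stuck exact T (i , _ , _ , occupied-i , occupied-i+1 , _) =
  <-irrefl refl (<-≤-trans (i<i+1 i)
    (≤-trans (proj₂ (proj₁ (exact _) occupied-i+1)) (proj₁ (proj₁ (exact i) occupied-i))))

singleton-empty : ∀ {C x j} → OccupiesExactly C x x → j ≢ x → occ C j ≡ 0
singleton-empty {C} {x} {j} exact j≢x = ¬occupied⇒empty {C} λ occupied-j →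
  j≢x (≤-antisym (proj₂ (proj₁ (exact j) occupied-j)) (proj₁ (proj₁ (exact j) occupied-j)))


Alternating : State → ℤ → ℕ → Set
Alternating U b zero    = ⊤
Alternating U b (suc k) = occ U b ≡ 1 × occ U (b + + 1) ≡ 0 × Alternating U (b + + 2) k

alternating-count : ∀ {U} b k → Alternating U b k → windowSum (λ j → + occ U j) b (2 ℕ.* k) ≡ + k
alternating-count b zero tt = refl
alternating-count {U} b (suc k) (occ-b , occ-b+1 , rest) = begin
  windowSum (λ j → + occ U j) b (2 ℕ.* suc k)
    ≡⟨ windowSum-2[1+k] (λ j → + occ U j) b k ⟩
  + occ U b + (+ occ U (b + + 1) + windowSum (λ j → + occ U j) (b + + 2) (2 ℕ.* k))
    ≡⟨ cong₂ (λ o o′ → + o + (+ o′ + windowSum (λ j → + occ U j) (b + + 2) (2 ℕ.* k)))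
             occ-b occ-b+1 ⟩
  + 1 + (+ 0 + windowSum (λ j → + occ U j) (b + + 2) (2 ℕ.* k))
    ≡⟨ cong (λ s → + 1 + (+ 0 + s)) (alternating-count (b + + 2) k rest) ⟩
  + suc k ∎

alternating-moment : ∀ {U} b k → Alternating U b k →
                     windowSum (λ j → + occ U j * j) b (2 ℕ.* k) ≡ + k * b + + k * (+ k - + 1)
alternating-moment b zero tt = refl
alternating-moment {U} b (suc k) (occ-b , occ-b+1 , rest) = begin
  windowSum (λ j → + occ U j * j) b (2 ℕ.* suc k)
    ≡⟨ windowSum-2[1+k] (λ j → + occ U j * j) b k ⟩
  + occ U b * b + (+ occ U (b + + 1) * (b + + 1) + windowSum (λ j → + occ U j * j) (b + + 2) (2 ℕ.* k))
    ≡⟨ cong₂ (λ o o′ → + o * b + (+ o′ * (b + + 1) + windowSum (λ j → + occ U j * j) (b + + 2) (2 ℕ.* k)))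
             occ-b occ-b+1 ⟩
  + 1 * b + (+ 0 * (b + + 1) + windowSum (λ j → + occ U j * j) (b + + 2) (2 ℕ.* k))
    ≡⟨ cong (λ s → + 1 * b + (+ 0 * (b + + 1) + s)) (alternating-moment (b + + 2) k rest) ⟩
  + 1 * b + (+ 0 * (b + + 1) + (+ k * (b + + 2) + + k * (+ k - + 1)))
    ≡⟨ regroup (+ k) b ⟩
  (+ 1 + + k) * b + (+ 1 + + k) * (+ 1 + + k - + 1) ∎
  where
  regroup : ∀ k b → + 1 * b + (+ 0 * (b + + 1) + (k * (b + + 2) + k * (k - + 1)))
                  ≡ (+ 1 + k) * b + (+ 1 + k) * (+ 1 + k - + 1)
  regroup = solve-∀

alternating-agree : ∀ {U V b} k → Alternating U b k → Alternating V b k →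
                    ∀ {j} → b ≤ j → j < b + + (2 ℕ.* k) → occ U j ≡ occ V j
alternating-agree {b = b} zero _ _ b≤j j<b+0 = ⊥-elim (<⇒≱ (subst (_ <_) (+-identityʳ b) j<b+0) b≤j)
alternating-agree {U} {V} {b} (suc k) (U-b , U-b+1 , U-rest) (V-b , V-b+1 , V-rest) {j} b≤j j<end
  with j ℤ.≟ b | j ℤ.≟ b + + 1
... | yes refl | _        = trans U-b (sym V-b)
... | no _     | yes refl = trans U-b+1 (sym V-b+1)
... | no j≢b   | no j≢b+1 = alternating-agree k U-rest V-rest
      (subst (_≤ j) (i+1+1≡i+2 b)
        (i<j⇒i+1≤j (≤∧≢⇒< (i<j⇒i+1≤j (≤∧≢⇒< b≤j (j≢b ∘ sym))) (j≢b+1 ∘ sym))))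
      (subst (j <_) end≡ j<end)
  where
  end≡ : b + + (2 ℕ.* suc k) ≡ b + + 2 + + (2 ℕ.* k)
  end≡ = trans (cong (λ n → b + + n) (2*[1+m]≡2+2*m k)) (sym (i+m+n≡i+[m+n] b 2 (2 ℕ.* k)))

record Chain (U : State) (a : ℤ) (L R : ℕ) : Set where
  field
    empty-left  : ∀ j → j < a → occ U j ≡ 0
    block-left  : Alternating U a L
    empty-gap   : occ U (a + + (2 ℕ.* L)) ≡ 0
    block-right : Alternating U (a + + (2 ℕ.* L) + + 1) R
    empty-right : ∀ j → a + + (2 ℕ.* L) + + 1 + + (2 ℕ.* R) ≤ j → occ U j ≡ 0

module _ {U : State} {a : ℤ} {L R : ℕ} (chainU : Chain U a L R) where
  open Chain chainU

  private
    g : ℤ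
    g = a + + (2 ℕ.* L)

    inside : ∀ j → Occupied U j → a ≤ j × j < a + + (2 ℕ.* L ℕ.+ suc (2 ℕ.* R))
    inside j occupied-j =
      ≮⇒≥ (λ j<a → empty⇒¬occupied {U} (empty-left j j<a) occupied-j) ,
      subst (j <_) end≡ (≰⇒> λ end≤j → empty⇒¬occupied {U} (empty-right j end≤j) occupied-j)
      where
      end≡ : g + + 1 + + (2 ℕ.* R) ≡ a + + (2 ℕ.* L ℕ.+ suc (2 ℕ.* R))
      end≡ = trans (i+m+n≡i+[m+n] g 1 (2 ℕ.* R)) (i+m+n≡i+[m+n] a (2 ℕ.* L) (suc (2 ℕ.* R)))

    windowSum-chain : ∀ f → windowSum f a (2 ℕ.* L ℕ.+ suc (2 ℕ.* R)) ≡
                      windowSum f a (2 ℕ.* L) + (f g + windowSum f (g + + 1) (2 ℕ.* R))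
    windowSum-chain f = trans (windowSum-++ f a (2 ℕ.* L) (suc (2 ℕ.* R)))
                              (cong (_+_ (windowSum f a (2 ℕ.* L))) (windowSum-suc f g _))

  chain-size : size U ≡ L ℕ.+ R
  chain-size = begin
    size U
      ≡⟨ size-window U inside ⟩
    ℤ.∣ windowSum (λ j → + occ U j) a (2 ℕ.* L ℕ.+ suc (2 ℕ.* R)) ∣
      ≡⟨ cong ℤ.∣_∣ (windowSum-chain (λ j → + occ U j)) ⟩
    ℤ.∣ windowSum (λ j → + occ U j) a (2 ℕ.* L) +
        (+ occ U g + windowSum (λ j → + occ U j) (g + + 1) (2 ℕ.* R)) ∣
      ≡⟨ cong ℤ.∣_∣ (cong₂ _+_ (alternating-count a L block-left)
                      (cong₂ (λ o s → + o + s) empty-gap (alternating-count (g + + 1) R block-right))) ⟩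
    ℤ.∣ + L + (+ 0 + + R) ∣
      ≡⟨ cong ℤ.∣_∣ (sym (pos-+ L R)) ⟩
    L ℕ.+ R ∎

  chain-moment : moment U ≡ + (L ℕ.+ R) * (a + + (L ℕ.+ R) - + 1) + + R
  chain-moment = begin
    moment U
      ≡⟨ moment-window U inside ⟩
    windowSum (λ j → + occ U j * j) a (2 ℕ.* L ℕ.+ suc (2 ℕ.* R))
      ≡⟨ windowSum-chain (λ j → + occ U j * j) ⟩
    windowSum (λ j → + occ U j * j) a (2 ℕ.* L) +
      (+ occ U g * g + windowSum (λ j → + occ U j * j) (g + + 1) (2 ℕ.* R))
      ≡⟨ cong₂ _+_ (alternating-moment a L block-left)
           (cong₂ (λ o s → + o * g + s) empty-gap (alternating-moment (g + + 1) R block-right)) ⟩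
    + L * a + + L * (+ L - + 1) + (+ 0 * g + (+ R * (g + + 1) + + R * (+ R - + 1)))
      ≡⟨ cong (λ d → + L * a + + L * (+ L - + 1) + (+ 0 * (a + d) + (+ R * (a + d + + 1) + + R * (+ R - + 1))))
              (pos-* 2 L) ⟩
    + L * a + + L * (+ L - + 1) + (+ 0 * (a + + 2 * + L) + (+ R * (a + + 2 * + L + + 1) + + R * (+ R - + 1)))
      ≡⟨ regroup (+ L) (+ R) a ⟩
    (+ L + + R) * (a + (+ L + + R) - + 1) + + R
      ≡⟨ cong (λ n → n * (a + n - + 1) + + R) (sym (pos-+ L R)) ⟩
    + (L ℕ.+ R) * (a + + (L ℕ.+ R) - + 1) + + R ∎
    where
    regroup : ∀ L R a → L * a + L * (L - + 1) + (+ 0 * (a + + 2 * L) + (R * (a + + 2 * L + + 1) + R * (R - + 1)))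
                      ≡ (L + R) * (a + (L + R) - + 1) + R
    regroup = solve-∀

module _ {U V : State} {a : ℤ} {L R : ℕ} (chainU : Chain U a L R) (chainV : Chain V a L R) where
  private
    module U = Chain chainU
    module V = Chain chainV

  chain-agree : ∀ j → occ U j ≡ occ V j
  chain-agree j with j <? a
  ... | yes j<a = trans (U.empty-left j j<a) (sym (V.empty-left j j<a))
  ... | no j≮a with j <? a + + (2 ℕ.* L)
  ...   | yes j<g = alternating-agree L U.block-left V.block-left (≮⇒≥ j≮a) j<g
  ...   | no j≮g with j ℤ.≟ a + + (2 ℕ.* L)
  ...     | yes refl = trans U.empty-gap (sym V.empty-gap)
  ...     | no j≢g with j <? a + + (2 ℕ.* L) + + 1 + + (2 ℕ.* R)
  ...       | yes j<end = alternating-agree R U.block-right V.block-right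
                            (i<j⇒i+1≤j (≤∧≢⇒< (≮⇒≥ j≮g) (j≢g ∘ sym))) j<end
  ...       | no j≮end = trans (U.empty-right j (≮⇒≥ j≮end)) (sym (V.empty-right j (≮⇒≥ j≮end)))


-- Final states

module FinalAnatomy (U : State) (final : Final U) (flanked : Flanked U) (gapBounded : GapBounded U) where

  occ≤1 : ∀ j → occ U j ℕ.≤ 1
  occ≤1 j with occ U j ℕ.≤? 1
  ... | yes occ≤1 = occ≤1
  ... | no occ≰1  = ⊥-elim (isolated (flanked j 2≤occ))
    where
    2≤occ : 2 ℕ.≤ occ U j
    2≤occ = ℕ.≰⇒> occ≰1
    occupied-j : Occupied U j
    occupied-j = ℕ.<-trans (s≤s z≤n) 2≤occ
    isolated : ¬ (Occupied U (j - + 1) ⊎ Occupied U (j + + 1))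
    isolated (inj₁ occupied-j-1) =
      final⇒¬adjacent {U} final occupied-j-1 (subst (Occupied U) (sym (i-1+1≡i j)) occupied-j)
    isolated (inj₂ occupied-j+1) = final⇒¬adjacent {U} final occupied-j occupied-j+1

  occupied⇒occ≡1 : ∀ {j} → Occupied U j → occ U j ≡ 1
  occupied⇒occ≡1 {j} occupied = ℕ.≤-antisym (occ≤1 j) occupied

  weight-occupied : ∀ {j} → Occupied U j → weightOf U j ≡ + 1
  weight-occupied occupied = cong weight (occupied⇒occ≡1 occupied)

  weight-empty : ∀ {j} → occ U j ≡ 0 → weightOf U j ≡ -1ℤ
  weight-empty empty = cong weight empty

  occupied⇒empty-right : ∀ {j} → Occupied U j → occ U (j + + 1) ≡ 0
  occupied⇒empty-right occupied = ¬occupied⇒empty {U} (final⇒¬adjacent {U} final occupied)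

  -- Every occupied room strictly between x and q is followed by an empty one before q.
  between-≤0 : ∀ {x q} → x < q → Occupied U q → between (weightOf U) x q ≤ + 0
  between-≤0 x<q occupied-q with i<j⇒j≡i+1+n x<q
  ... | n , q≡x+1+n = proj₁ (bound n q≡x+1+n occupied-q)
    where
    bound : ∀ n {x q} → q ≡ x + + suc n → Occupied U q →
            between (weightOf U) x q ≤ + 0 × (occ U (x + + 1) ≡ 0 → between (weightOf U) x q ≤ -1ℤ)
    bound zero {x} refl occupied-x+1 =
      ≤-reflexive (between-adjacent _ x) , λ empty → ⊥-elim (empty⇒¬occupied {U} empty occupied-x+1)
    bound (suc n) {x} refl occupied-q
      with between-cons (weightOf U) (i+1<i+2+n x n) | occupied? U (x + + 1)
         | bound n {x + + 1} (sym (i+1+n≡i+[1+n] x (suc n))) occupied-q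
    ... | cons | yes occupied-x+1 | _ , ≤-1 =
      subst (_≤ + 0) (sym cons)
        (+-mono-≤ (≤-reflexive (weight-occupied occupied-x+1)) (≤-1 (occupied⇒empty-right occupied-x+1))) ,
      λ empty → ⊥-elim (empty⇒¬occupied {U} empty occupied-x+1)
    ... | cons | no ¬occupied-x+1 | ≤0 , _ = ≤-trans ≤-1 -≤+ , λ _ → ≤-1
      where
      ≤-1 : between (weightOf U) x (x + + suc (suc n)) ≤ -1ℤ
      ≤-1 = subst (_≤ -1ℤ) (sym cons)
              (+-mono-≤ (≤-reflexive (weight-empty (¬occupied⇒empty {U} ¬occupied-x+1))) ≤0)

  -- Room p + 1 is empty; were p + 2 empty too, between-≤0 would push the sum below −1.
  alternating-span : ∀ n {p q} → q ≡ p + + n → Occupied U p → Occupied U q →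
                     (p < q → -1ℤ ≤ between (weightOf U) p q) →
                     ∃ λ m → n ≡ 2 ℕ.* m × Alternating U p (suc m)
  alternating-span zero _ occupied-p _ _ =
    0 , refl , occupied⇒occ≡1 occupied-p , occupied⇒empty-right occupied-p , tt
  alternating-span (suc zero) refl occupied-p occupied-q _ =
    ⊥-elim (final⇒¬adjacent {U} final occupied-p occupied-q)
  alternating-span (suc (suc n)) {p} {q} refl occupied-p occupied-q slack
    with alternating-span n {p + + 2} {q} (sym (i+m+n≡i+[m+n] p 2 n)) occupied-p+2 occupied-q slack-p+2
    where
    p<q : p < q
    p<q = i<i+1+n p (suc n)
    split : p + + 2 < q →
            between (weightOf U) p q ≡ -1ℤ + (weightOf U (p + + 2) + between (weightOf U) (p + + 2) q)
    split p+2<q = trans (between-cons₂ _ p+2<q)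
      (cong (_+ (weightOf U (p + + 2) + between (weightOf U) (p + + 2) q))
            (weight-empty (occupied⇒empty-right occupied-p)))
    occupied-p+2 : Occupied U (p + + 2)
    occupied-p+2 with p + + 2 ℤ.≟ q | occupied? U (p + + 2)
    ... | yes p+2≡q | _            = subst (Occupied U) (sym p+2≡q) occupied-q
    ... | no _      | yes occupied = occupied
    ... | no p+2≢q  | no ¬occupied =
      ⊥-elim (-1≰-2 (≤-trans (slack p<q) (subst (_≤ - + 2) (sym (split p+2<q)) too-low)))
      where
      p+2<q : p + + 2 < q
      p+2<q = ≤∧≢⇒< (subst (p + + 2 ≤_) (i+m+n≡i+[m+n] p 2 n) (i≤i+n (p + + 2) n)) p+2≢q
      too-low : -1ℤ + (weightOf U (p + + 2) + between (weightOf U) (p + + 2) q) ≤ - + 2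
      too-low = +-monoʳ-≤ -1ℤ (+-mono-≤ (≤-reflexive (weight-empty (¬occupied⇒empty {U} ¬occupied)))
                                        (between-≤0 p+2<q occupied-q))
      -1≰-2 : ¬ (-1ℤ ≤ - + 2)
      -1≰-2 (-≤- ())
    slack-p+2 : p + + 2 < q → -1ℤ ≤ between (weightOf U) (p + + 2) q
    slack-p+2 p+2<q = subst (-1ℤ ≤_) (begin
      between (weightOf U) p q
        ≡⟨ split p+2<q ⟩
      -1ℤ + (weightOf U (p + + 2) + between (weightOf U) (p + + 2) q)
        ≡⟨ cong (λ w → -1ℤ + (w + between (weightOf U) (p + + 2) q)) (weight-occupied occupied-p+2) ⟩
      -1ℤ + (+ 1 + between (weightOf U) (p + + 2) q)
        ≡⟨ -1+[1+x]≡x (between (weightOf U) (p + + 2) q) ⟩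
      between (weightOf U) (p + + 2) q ∎) (slack p<q)
      where
      -1+[1+x]≡x : ∀ x → -1ℤ + (+ 1 + x) ≡ x
      -1+[1+x]≡x = solve-∀
  ... | m , n≡2m , alternating = suc m , trans (cong (λ k → suc (suc k)) n≡2m) (sym (2*[1+m]≡2+2*m m)) ,
        occupied⇒occ≡1 occupied-p , occupied⇒empty-right occupied-p , alternating

  -- The bound across the empty pair x + 1, x + 2 leaves slack −1 on either side of it, so
  -- alternating-span runs from the leftmost occupied room to x and from x + 3 to the rightmost.
  module AroundGap {x : ℤ} (occupied-x : Occupied U x) (empty-x+1 : occ U (x + + 1) ≡ 0)
                   (empty-x+2 : occ U (x + + 2) ≡ 0) (occupied-x+3 : Occupied U (x + + 3)) where

    x<x+3 : x < x + + 3
    x<x+3 = i<i+1+n x 2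

    between-gap : between (weightOf U) x (x + + 3) ≡ - + 2
    between-gap = begin
      between (weightOf U) x (x + + 3)
        ≡⟨ between-cons₂ _ (subst (x + + 2 <_) (+-assoc x (+ 2) (+ 1)) (i<i+1 (x + + 2))) ⟩
      weightOf U (x + + 1) + (weightOf U (x + + 2) + between (weightOf U) (x + + 2) (x + + 3))
        ≡⟨ cong₂ (λ w w′ → w + (w′ + between (weightOf U) (x + + 2) (x + + 3)))
                 (weight-empty empty-x+1) (weight-empty empty-x+2) ⟩
      -1ℤ + (-1ℤ + between (weightOf U) (x + + 2) (x + + 3))
        ≡⟨ cong (λ b → -1ℤ + (-1ℤ + b)) (trans (cong (between (weightOf U) (x + + 2)) (sym (+-assoc x (+ 2) (+ 1))))
                                                (between-adjacent _ (x + + 2))) ⟩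
      - + 2 ∎

    slack-left : ∀ {p} → p < x → Occupied U p → -1ℤ ≤ between (weightOf U) p x
    slack-left {p} p<x occupied-p = -2≤x-1⇒-1≤x (subst (- + 2 ≤_) split
      (gapBounded (<-trans p<x x<x+3) occupied-p occupied-x+3))
      where
      split : between (weightOf U) p (x + + 3) ≡ between (weightOf U) p x - + 1
      split = trans (between-split _ p<x x<x+3)
        (cong₂ (λ w b → between (weightOf U) p x + (w + b)) (weight-occupied occupied-x) between-gap)

    slack-right : ∀ {q} → x + + 3 < q → Occupied U q → -1ℤ ≤ between (weightOf U) (x + + 3) q
    slack-right {q} x+3<q occupied-q = -2≤x-1⇒-1≤x (subst (- + 2 ≤_) split
      (gapBounded (<-trans x<x+3 x+3<q) occupied-x occupied-q))
      where
      -2+[1+c]≡c-1 : ∀ c → - + 2 + (+ 1 + c) ≡ c - + 1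
      -2+[1+c]≡c-1 = solve-∀
      split : between (weightOf U) x q ≡ between (weightOf U) (x + + 3) q - + 1
      split = trans (between-split _ x<x+3 x+3<q)
        (trans (cong₂ (λ b w → b + (w + between (weightOf U) (x + + 3) q))
                      between-gap (weight-occupied occupied-x+3))
               (-2+[1+c]≡c-1 (between (weightOf U) (x + + 3) q)))

    chain : ∃ λ a → ∃ λ L → ∃ λ R → Chain U a (suc L) (suc R)
    chain
      with least (Occupied U) (occupied? U) (λ _ occupied → proj₁ (occupied⇒inWindow U occupied)) occupied-x
         | greatest (Occupied U) (occupied? U)
             (λ _ occupied → i<j⇒i≤j-1 (proj₂ (occupied⇒inWindow U occupied))) occupied-x+3
    ... | a , occupied-a , a≤occupied | b , occupied-b , occupied≤b
      with i≤j⇒j≡i+n (a≤occupied x occupied-x) | i≤j⇒j≡i+n (occupied≤b (x + + 3) occupied-x+3)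
    ... | n , x≡a+n | n′ , b≡x+3+n′
      with alternating-span n x≡a+n occupied-a occupied-x (λ a<x → slack-left a<x occupied-a)
         | alternating-span n′ b≡x+3+n′ occupied-x+3 occupied-b (λ x+3<b → slack-right x+3<b occupied-b)
    ... | m , refl , left | m′ , refl , right = a , m , m′ , record
      { empty-left  = λ j j<a → ¬occupied⇒empty {U} λ occupied-j → <⇒≱ j<a (a≤occupied j occupied-j)
      ; block-left  = left
      ; empty-gap   = subst (λ k → occ U k ≡ 0) (sym gap≡x+2) empty-x+2
      ; block-right = subst (λ k → Alternating U k (suc m′)) (sym right≡x+3) right
      ; empty-right = λ j end≤j → ¬occupied⇒empty {U} λ occupied-j →
          <⇒≱ (<-≤-trans (<-≤-trans (i<i+1+n b 1) (≤-reflexive (sym end≡b+2))) end≤j)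
              (occupied≤b j occupied-j)
      }
      where
      gap≡x+2 : a + + (2 ℕ.* suc m) ≡ x + + 2
      gap≡x+2 = trans (i+2[1+m]≡i+2m+2 a m) (cong (_+ + 2) (sym x≡a+n))
      right≡x+3 : a + + (2 ℕ.* suc m) + + 1 ≡ x + + 3
      right≡x+3 = trans (cong (_+ + 1) gap≡x+2) (+-assoc x (+ 2) (+ 1))
      end≡b+2 : a + + (2 ℕ.* suc m) + + 1 + + (2 ℕ.* suc m′) ≡ b + + 2
      end≡b+2 = trans (cong (_+ + (2 ℕ.* suc m′)) right≡x+3)
                      (trans (i+2[1+m]≡i+2m+2 (x + + 3) m′) (cong (_+ + 2) (sym b≡x+3+n′)))


-- The centroid

N*q+ρ<N*q′+ρ′ : ∀ N {q q′ ρ ρ′} → q < q′ → ρ ℕ.< N → + N * q + + ρ < + N * q′ + + ρ′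
N*q+ρ<N*q′+ρ′ N {q} {q′} {ρ} {ρ′} q<q′ ρ<N =
  <-≤-trans (+-monoʳ-< (+ N * q) (+<+ ρ<N))
  (≤-trans (≤-reflexive (N*q+N≡N*[q+1] (+ N) q))
  (≤-trans (*-monoˡ-≤-nonNeg (+ N) (i<j⇒i+1≤j q<q′)) (i≤i+n (+ N * q′) ρ′)))
  where
  N*q+N≡N*[q+1] : ∀ N q → N * q + N ≡ N * (q + + 1)
  N*q+N≡N*[q+1] = solve-∀

N*q+ρ-injective : ∀ N {q q′ ρ ρ′} → ρ ℕ.< N → ρ′ ℕ.< N →
                  + N * q + + ρ ≡ + N * q′ + + ρ′ → q ≡ q′ × ρ ≡ ρ′
N*q+ρ-injective N {q} {q′} ρ<N ρ′<N eq with <-cmp q q′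
... | tri< q<q′ _ _ = ⊥-elim (<-irrefl eq (N*q+ρ<N*q′+ρ′ N q<q′ ρ<N))
... | tri≈ _ refl _ = refl , +-injective (+-cancelˡ-≡ (+ N * q) _ _ eq)
... | tri> _ _ q′<q = ⊥-elim (<-irrefl (sym eq) (N*q+ρ<N*q′+ρ′ N q′<q ρ′<N))

centroid≡moment/size : ∀ S {n} → size S ≡ suc n → centroid S ≡ moment S / suc n
centroid≡moment/size S size≡ rewrite size≡ = refl

/-cancelʳ-≡ : ∀ {p q} n → p / suc n ≡ q / suc n → p ≡ q
/-cancelʳ-≡ {p} {q} n eq with /-injective-≃ (mkℚᵘ p n) (mkℚᵘ q n) eq
... | *≡* p*n≡q*n = *-cancelʳ-≡ p q (+ suc n) p*n≡q*n

data FinalShape (S : State) (N : ℕ) : Set where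
  singleton : ∀ x → occ S x ≡ N → (∀ j → j ≢ x → occ S j ≡ 0) → FinalShape S N
  chain     : ∀ a L R → Chain S a (suc L) (suc R) → suc L ℕ.+ suc R ≡ N → FinalShape S N

-- moment S ≡ N · quotient + remainder with remainder < N, so the centroid determines both.
quotient : ∀ {S N} → FinalShape S N → ℤ
quotient (singleton x _ _)          = x
quotient {N = N} (chain a _ _ _ _)  = a + + N - + 1

remainder : ∀ {S N} → FinalShape S N → ℕ
remainder (singleton _ _ _)   = 0
remainder (chain _ _ R _ _)   = suc R

remainder<N : ∀ {S n} (shape : FinalShape S (suc n)) → remainder shape ℕ.< suc n
remainder<N (singleton _ _ _)      = s≤s z≤n
remainder<N (chain _ L R _ refl)   = ℕ.m<n+m (suc R) (s≤s z≤n)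

moment-shape : ∀ {S N} (shape : FinalShape S N) → moment S ≡ + N * quotient shape + + remainder shape
moment-shape {S} {N} (singleton x occ-x empty) = begin
  moment S                             ≡⟨ moment-window S inside ⟩
  windowSum (λ j → + occ S j * j) x 1  ≡⟨ windowSum-1 (λ j → + occ S j * j) x ⟩
  + occ S x * x                        ≡⟨ cong (λ n → + n * x) occ-x ⟩
  + N * x                              ≡⟨ +-identityʳ (+ N * x) ⟨
  + N * x + + 0                        ∎
  where
  inside : ∀ j → Occupied S j → x ≤ j × j < x + + 1
  inside j occupied-j with j ℤ.≟ x
  ... | yes refl = ≤-refl , i<i+1 j
  ... | no j≢x   = ⊥-elim (empty⇒¬occupied {S} (empty j j≢x) occupied-j)
moment-shape (chain a L R chainS refl) = chain-moment chainS

shape-determines : ∀ {S S′ N} (shape : FinalShape S N) (shape′ : FinalShape S′ N) →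
                   quotient shape ≡ quotient shape′ → remainder shape ≡ remainder shape′ →
                   ∀ j → occ S j ≡ occ S′ j
shape-determines (singleton x occ-x empty) (singleton .x occ′-x empty′) refl _ j with j ℤ.≟ x
... | yes refl = trans occ-x (sym occ′-x)
... | no j≢x   = trans (empty j j≢x) (sym (empty′ j j≢x))
shape-determines (singleton _ _ _) (chain _ _ _ _ _) _ ()
shape-determines (chain _ _ _ _ _) (singleton _ _ _) _ ()
shape-determines {N = N} (chain a L R chainS size≡) (chain a′ L′ .R chainS′ size≡′) a+N-1≡a′+N-1 refl
  with ℕ.+-cancelʳ-≡ (suc R) (suc L) (suc L′) (trans size≡ (sym size≡′))
     | +-cancelʳ-≡ (+ N) a a′ (+-cancelʳ-≡ (- + 1) _ _ a+N-1≡a′+N-1)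
... | refl | refl = chain-agree chainS chainS′

singleton-final-shape : ∀ {N C S x} → size C ≡ N → OccupiesExactly C x x → Reachable C S → FinalShape S N
singleton-final-shape {N} {C} {S} {x} size≡N exact reach
  with Reachable-from-stuck (singleton-stuck {C} {x} exact) reach
... | refl = singleton x occ-x λ j j≢x → singleton-empty {C} {x} exact j≢x
  where
  inside : ∀ j → Occupied C j → x ≤ j × j < x + + 1
  inside j occupied-j with proj₁ (exact j) occupied-j
  ... | x≤j , j≤x = x≤j , ≤-<-trans j≤x (i<i+1 x)
  occ-x : occ C x ≡ N
  occ-x = trans (sym (trans (size-window C inside) (cong ℤ.∣_∣ (windowSum-1 (λ j → + occ C j) x)))) size≡N

chain-final-shape : ∀ {N S} → size S ≡ N → (∃ λ a → ∃ λ L → ∃ λ R → Chain S a (suc L) (suc R)) →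
                    FinalShape S N
chain-final-shape size≡N (a , L , R , chainS) = chain a L R chainS (trans (sym (chain-size chainS)) size≡N)

interval-final-shape : ∀ {N C S L U} → size C ≡ N → L < U → OccupiesExactly C L U →
                       Reachable C S → Final S → FinalShape S N
interval-final-shape {N} {C} {S} size≡N L<U exact reach final =
  chain-final-shape (trans (Reachable⇒size≡ reach) size≡N) (chain-around (proj₂ doubleGap))
  where
  invariants : Flanked S × GapBounded S
  invariants = Reachable-preserves (λ T → Flanked T × GapBounded T)
    (λ {S} {T} m (flankedS , gapBoundedS) →
       Move⇒flanked {S} {T} m flankedS , Move⇒gapBounded {S} {T} m gapBoundedS)
    reach (interval-flanked {C} L<U exact , interval-gapBounded {C} exact)
  doubleGap : ∃ (DoubleGap S)
  doubleGap = Reachable⇒final⇒doubleGap reach (interval-¬final {C} L<U exact) final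
  chain-around : ∀ {x} → DoubleGap S x → ∃ λ a → ∃ λ L → ∃ λ R → Chain S a (suc L) (suc R)
  chain-around {x} (occupied-x , empty-x+1 , empty-x+2 , occupied-x+3) =
    FinalAnatomy.AroundGap.chain S final (proj₁ invariants) (proj₂ invariants) {x}
      occupied-x empty-x+1 empty-x+2 occupied-x+3

final-shape : ∀ {N C S} → Clusteron N C → Reachable C S → Final S → FinalShape S N
final-shape (size≡N , L , U , L≤U , exact) reach final with L ℤ.≟ U
... | yes refl = singleton-final-shape size≡N exact reach
... | no L≢U   = interval-final-shape size≡N (≤∧≢⇒< L≤U L≢U) exact reach final

proposition5p10 : (N : ℕ) → 2 ℕ.≤ N → (C C' S S' : State) →
    Clusteron N C → Clusteron N C' → Reachable C S → Reachable C' S' →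
    Final S → Final S' → ¬ (∀ i → occ S i ≡ occ S' i) →
    centroid S ≢ centroid S'
proposition5p10 zero ()
proposition5p10 (suc n) _ C C′ S S′ clusteronC clusteronC′ reach reach′ final final′ S≢S′ centroid≡ =
  S≢S′ (shape-determines shape shape′ (proj₁ quotient≡∧remainder≡) (proj₂ quotient≡∧remainder≡))
  where
  shape : FinalShape S (suc n)
  shape = final-shape clusteronC reach final
  shape′ : FinalShape S′ (suc n)
  shape′ = final-shape clusteronC′ reach′ final′
  moment≡ : moment S ≡ moment S′
  moment≡ = /-cancelʳ-≡ n (begin
    moment S / suc n   ≡⟨ centroid≡moment/size S (trans (Reachable⇒size≡ reach) (proj₁ clusteronC)) ⟨
    centroid S         ≡⟨ centroid≡ ⟩
    centroid S′        ≡⟨ centroid≡moment/size S′ (trans (Reachable⇒size≡ reach′) (proj₁ clusteronC′)) ⟩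
    moment S′ / suc n  ∎)
  quotient≡∧remainder≡ : quotient shape ≡ quotient shape′ × remainder shape ≡ remainder shape′
  quotient≡∧remainder≡ = N*q+ρ-injective (suc n) (remainder<N shape) (remainder<N shape′)
    (trans (sym (moment-shape shape)) (trans moment≡ (moment-shape shape′)))
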